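{- Let $\ell\ge1$. A set $X\subseteq\mathbb{N}$ is $\mathcal{B}_\ell$-recognizable if and only if $\Psi(\mathrm{rep}_\ell(X))\subseteq\mathbb{N}^\ell$ is a semi-linear set whose periods are integer multiples of the canonical vectors $\mathbf{e}_1,\ldots,\mathbf{e}_\ell$.
   Context: For $\ell\ge1$ let $\Sigma_\ell=\{a_1<\cdots<a_\ell\}$ and $\mathcal{B}_\ell=a_1^*\cdots a_\ell^*$. For $n\ge0$, $\mathrm{rep}_\ell(n)$ is the $(n+1)$-st word of $\mathcal{B}_\ell$ in genealogical order (shorter words first; equal-length words ordered lexicographically). $X\subseteq\mathbb{N}$ is $\mathcal{B}_\ell$-recognizable if $\mathrm{rep}_\ell(X)$ is a regular language. The Parikh map is $\Psi(w)=(|w|_{a_1},\ldots,|w|_{a_\ell})$, where $|w|_{a_j}$ is the number of occurrences of $a_j$ in $w$. A set $Z\subseteq\mathbb{N}^\ell$ is linear if $Z=\mathbf{p}_0+\mathbb{N}\mathbf{p}_1+\cdots+\mathbb{N}\mathbf{p}_k$ for some $\mathbf{p}_0,\ldots,\mathbf{p}_k\in\mathbb{N}^\ell$; $\mathbf{p}_1,\ldots,\mathbf{p}_k$ are its periods. A set is semi-linear if it is a finite union of linear sets; its periods are the union of the periods of these linear sets. $\mathbf{e}_i$ is the vector with $1$ in coordinate $i$ and $0$ elsewhere. -}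

module Defs where

open import Data.Nat using (ℕ; _+_; _*_; _≤_)
open import Data.Fin as Fin using (Fin)
open import Data.List as List using (List; []; _∷_; length)
open import Data.List.Membership.Propositional using (_∈_)
open import Data.List.Relation.Unary.Any using (Any)
open import Data.List.Relation.Unary.All using (All)
open import Data.List.Relation.Unary.Unique.Propositional using (Unique)
open import Data.Vec as Vec using (Vec)
open import Data.Product using (Σ; ∃; _×_; proj₁; proj₂)
open import Data.Sum using (_⊎_)
open import Data.Bool using (Bool; true; false; if_then_else_)
open import Relation.Nullary.Decidable using (⌊_⌋)
open import Relation.Binary.PropositionalEquality using (_≡_)
open import Function.Bundles using (_⇔_)

-- Alphabet Σ_ℓ = Fin ℓ, with a_{i+1} = i and the order of Fin.
Word : ℕ → Set
Word ℓ = List (Fin ℓ)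

record DFA (ℓ : ℕ) : Set where
  field
    nStates : ℕ
    start   : Fin nStates
    δ       : Fin nStates → Fin ℓ → Fin nStates
    final   : Fin nStates → Bool

run : ∀ {ℓ} (D : DFA ℓ) → Fin (DFA.nStates D) → Word ℓ → Fin (DFA.nStates D)
run D q []       = q
run D q (a ∷ w)  = run D (DFA.δ D q a) w

accepts : ∀ {ℓ} → DFA ℓ → Word ℓ → Bool
accepts D w = DFA.final D (run D (DFA.start D) w)

Regular : ∀ {ℓ} → (Word ℓ → Set) → Set
Regular {ℓ} L = Σ (DFA ℓ) λ D → ∀ w → L w ⇔ (accepts D w ≡ true)

blockWord : ∀ {ℓ} → Vec ℕ ℓ → Word ℓ
blockWord {ℓ} k = List.concat (Vec.toList (Vec.zipWith List.replicate k (Vec.allFin ℓ)))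

InB : ∀ ℓ → Word ℓ → Set
InB ℓ w = Σ (Vec ℕ ℓ) λ k → w ≡ blockWord k

-- Strict lexicographic order (used on words of equal length)
data _<lex_ {ℓ : ℕ} : Word ℓ → Word ℓ → Set where
  here  : ∀ {x y xs ys} → x Fin.< y → (x ∷ xs) <lex (y ∷ ys)
  there : ∀ {x xs ys} → xs <lex ys → (x ∷ xs) <lex (x ∷ ys)

_<gen_ : ∀ {ℓ} → Word ℓ → Word ℓ → Set
v <gen w = (length v Data.Nat.< length w) ⊎ ((length v ≡ length w) × (v <lex w))
  where import Data.Nat

-- RepIs ℓ n w : w = rep_ℓ(n), i.e. w ∈ B_ℓ and exactly n words of B_ℓ
-- precede w in genealogical order.
RepIs : ∀ ℓ → ℕ → Word ℓ → Set
RepIs ℓ n w = InB ℓ w × Σ (List (Word ℓ)) λ P →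
  Unique P × (∀ v → (v ∈ P) ⇔ (InB ℓ v × (v <gen w))) × (length P ≡ n)

repSet : ∀ ℓ → (ℕ → Set) → Word ℓ → Set
repSet ℓ X w = Σ ℕ λ n → X n × RepIs ℓ n w

Recognizable : ∀ ℓ → (ℕ → Set) → Set
Recognizable ℓ X = Regular (repSet ℓ X)

occ : ∀ {ℓ} → Fin ℓ → Word ℓ → ℕ
occ i []      = 0
occ i (a ∷ w) = (if ⌊ i Fin.≟ a ⌋ then 1 else 0) + occ i w

Ψ : ∀ {ℓ} → Word ℓ → Vec ℕ ℓ
Ψ w = Vec.tabulate (λ i → occ i w)

ΨImage : ∀ {ℓ} → (Word ℓ → Set) → Vec ℕ ℓ → Set
ΨImage {ℓ} L v = Σ (Word ℓ) λ w → L w × (Ψ w ≡ v)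

_⊕_ : ∀ {ℓ} → Vec ℕ ℓ → Vec ℕ ℓ → Vec ℕ ℓ
_⊕_ = Vec.zipWith _+_

_⊙_ : ∀ {ℓ} → ℕ → Vec ℕ ℓ → Vec ℕ ℓ
c ⊙ v = Vec.map (c *_) v

e : ∀ {ℓ} → Fin ℓ → Vec ℕ ℓ
e i = Vec.tabulate (λ j → if ⌊ i Fin.≟ j ⌋ then 1 else 0)

InLinear : ∀ {ℓ} → Vec ℕ ℓ → List (Vec ℕ ℓ) → Vec ℕ ℓ → Set
InLinear p0 []       v = v ≡ p0
InLinear p0 (p ∷ ps) v = Σ ℕ λ c → Σ _ λ u → InLinear p0 ps u × (v ≡ u ⊕ (c ⊙ p))

LinPres : ℕ → Set
LinPres ℓ = Vec ℕ ℓ × List (Vec ℕ ℓ)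

MultCanon : ∀ {ℓ} → Vec ℕ ℓ → Set
MultCanon {ℓ} p = Σ ℕ λ c → Σ (Fin ℓ) λ i → p ≡ c ⊙ e i

SemiLinearCanon : ∀ ℓ → (Vec ℕ ℓ → Set) → Set
SemiLinearCanon ℓ Z = Σ (List (LinPres ℓ)) λ Ls →
  All (λ L → All MultCanon (proj₂ L)) Ls ×
  (∀ v → Z v ⇔ Any (λ L → InLinear (proj₁ L) (proj₂ L) v) Ls)

module Submission where

-- rep_ℓ(X) is a language of block words a_1^{k_1}⋯a_ℓ^{k_ℓ}, and on block
-- words the Parikh map Ψ is inverted by blockWord.  So the theorem is an
-- instance of: a language L ⊆ B_ℓ is regular iff Ψ(L) is semi-linear with
-- canonical periods.  Both sides are shown equivalent to an arithmetic
-- property of Z = Ψ(L): Z is decidable and *periodic* with some threshold T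
-- and period P > 0, i.e. once v_i ≥ T, v ∈ Z ⇔ v + P·e_i ∈ Z.
--
--  * Block words: Ψ ∘ blockWord = id, and B_ℓ is the set of sorted words.
--  * Regular ⇒ periodic: an N-state DFA cannot tell a block of length ≥ N
--    from the same block lengthened by N! (pigeonhole on the orbit of a state).
--  * Reduction: a periodic set only depends on the residues of the coordinates
--    in {0, …, T+P-1}, computed by a finite counter.
--  * Periodic ⇒ semi-linear: one linear set r + Σ ℕ q_i e_i per residue
--    vector r ∈ Z, with q_i = P above the threshold and 0 below.
--  * Semi-linear ⇒ periodic and decidable: with P the product of the period
--    lengths, each linear set is periodic (add or drop P·e_i through a period
--    along e_i), and finite unions of periodic sets are periodic.
--  * Periodic ⇒ regular: a DFA checks sortedness and counts letters modulo (T, P).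
-- lemma22 combines the two directions for L = rep_ℓ(X).

open import Defs
open import Level using (0ℓ)
open import Data.Nat as ℕ
  using (ℕ; zero; suc; _+_; _*_; _∸_; _≤_; _<_; _≟_; _≤?_; z≤n; s≤s; pred; _!; >-nonZero⁻¹)
open import Data.Nat.Properties
open import Data.Nat.Divisibility using (_∣_; divides; ∣-trans; m∣m*n; m≤n⇒m!∣n!)
open import Data.Nat.GeneralisedArithmetic using (fold; fold-+)
import Data.Nat.ListAction as ListAction
open import Data.Nat.ListAction using (product)
open import Data.Nat.ListAction.Properties using (∈⇒∣product; product≢0)
open import Algebra.Properties.CommutativeSemigroup +-commutativeSemigroup using (interchange; xy∙z≈xz∙y)
open import Data.Fin as Fin using (Fin; toℕ; fromℕ<) renaming (zero to fz; suc to fs)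
import Data.Fin.Properties as FinP
open import Data.List as List using (List; []; _∷_; _++_; replicate; concat; length)
import Data.List.Properties as ListP
open import Data.List.Membership.Propositional using (_∈_; find; lose)
open import Data.List.Membership.Propositional.Properties
  using (∈-map⁺; ∈-cartesianProduct⁺; ∈-allFin; ∈-filter⁺; ∈-filter⁻; ∈-concatMap⁺)
open import Data.List.Relation.Unary.Any as Any using (Any; here; there)
import Data.List.Relation.Unary.Any.Properties as AnyP
open import Data.List.Relation.Unary.All as All using (All; []; _∷_)
import Data.List.Relation.Unary.All.Properties as AllP
open import Data.Vec as Vec using (Vec; []; _∷_; lookup; tabulate; zipWith; updateAt)
import Data.Vec.Properties as VecP
open import Data.Product using (Σ; ∃; _×_; _,_; proj₁; proj₂; uncurry)
open import Data.Sum using (_⊎_; inj₁; inj₂)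
open import Data.Bool using (Bool; true; false; if_then_else_; _∧_)
import Data.Bool.Properties as BoolP
open import Data.Empty using (⊥-elim)
open import Relation.Nullary.Decidable using (Dec; yes; no; ⌊_⌋; map′; _×-dec_)
open import Relation.Unary using (Decidable)
open import Relation.Binary.PropositionalEquality
open import Relation.Binary.Structures using (IsEquivalence)
import Relation.Binary.Reasoning.Setoid as SetoidReasoning
open import Function using (_∘_; id)
open import Function.Bundles using (_⇔_; mk⇔; Equivalence)
open import Function.Properties.Equivalence using (⇔-setoid; ⇔-isEquivalence)

open IsEquivalence (⇔-isEquivalence {0ℓ})
  using () renaming (refl to ⇔-refl; sym to ⇔-sym; trans to ⇔-trans)
module ⇔-Reasoning = SetoidReasoning (⇔-setoid 0ℓ)

⇔-cong : ∀ {A : Set} (Z : A → Set) {x y} → x ≡ y → Z x ⇔ Z y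
⇔-cong Z refl = ⇔-refl

dec-true : ∀ {A : Set} (d : Dec A) → A ⇔ (⌊ d ⌋ ≡ true)
dec-true (yes a) = mk⇔ (λ _ → refl) (λ _ → a)
dec-true (no ¬a) = mk⇔ (λ a → ⊥-elim (¬a a)) (λ ())

∧-true : ∀ {a b} → a ∧ b ≡ true → a ≡ true × b ≡ true
∧-true {true} p = refl , p

kron : ∀ {n} → Fin n → Fin n → ℕ
kron i j = if ⌊ i Fin.≟ j ⌋ then 1 else 0

kron-refl : ∀ {n} (i : Fin n) → kron i i ≡ 1
kron-refl i with i Fin.≟ i
... | yes _ = refl
... | no i≢i = ⊥-elim (i≢i refl)

kron-≢ : ∀ {n} {i j : Fin n} → i ≢ j → kron i j ≡ 0
kron-≢ {i = i} {j} i≢j with i Fin.≟ j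
... | yes i≡j = ⊥-elim (i≢j i≡j)
... | no _ = refl

kron-suc : ∀ {n} (i j : Fin n) → kron (fs i) (fs j) ≡ kron i j
kron-suc i j with i Fin.≟ j
... | yes _ = refl
... | no _ = refl

lookup-ext : ∀ {A : Set} {n} {u v : Vec A n} → (∀ j → lookup u j ≡ lookup v j) → u ≡ v
lookup-ext {u = u} {v} p =
  trans (sym (VecP.tabulate∘lookup u)) (trans (VecP.tabulate-cong p) (VecP.tabulate∘lookup v))

lookup-⊕ : ∀ {n} (u v : Vec ℕ n) j → lookup (u ⊕ v) j ≡ lookup u j + lookup v j
lookup-⊕ u v j = VecP.lookup-zipWith _+_ j u v

lookup-⊙e : ∀ {n} c (i j : Fin n) → lookup (c ⊙ e i) j ≡ c * kron i j
lookup-⊙e c i j =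
  trans (VecP.lookup-map j (c *_) (e i)) (cong (c *_) (VecP.lookup∘tabulate (kron i) j))

lookup-⊕⊙e : ∀ {n} (u : Vec ℕ n) c (i j : Fin n) → lookup (u ⊕ (c ⊙ e i)) j ≡ lookup u j + c * kron i j
lookup-⊕⊙e u c i j = trans (lookup-⊕ u (c ⊙ e i) j) (cong (lookup u j +_) (lookup-⊙e c i j))

⊕⊙e-fz : ∀ {n} x (u : Vec ℕ n) c → (x ∷ u) ⊕ (c ⊙ e fz) ≡ (x + c) ∷ u
⊕⊙e-fz x u c = lookup-ext λ
  { fz     → cong (x +_) (*-identityʳ c)
  ; (fs j) → trans (lookup-⊕⊙e (x ∷ u) c fz (fs j)) (trans (cong (lookup u j +_) (*-zeroʳ c)) (+-identityʳ _)) }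

⊕⊙e-fs : ∀ {n} x (u : Vec ℕ n) c i → (x ∷ u) ⊕ (c ⊙ e (fs i)) ≡ x ∷ (u ⊕ (c ⊙ e i))
⊕⊙e-fs x u c i = lookup-ext λ
  { fz     → trans (cong (x +_) (*-zeroʳ c)) (+-identityʳ x)
  ; (fs j) → trans (lookup-⊕⊙e (x ∷ u) c (fs i) (fs j))
               (trans (cong (λ d → lookup u j + c * d) (kron-suc i j)) (sym (lookup-⊕⊙e u c i j))) }

⊕-0⊙ : ∀ {n} (v p : Vec ℕ n) → v ⊕ (0 ⊙ p) ≡ v
⊕-0⊙ [] [] = refl
⊕-0⊙ (x ∷ v) (y ∷ p) = cong₂ _∷_ (+-identityʳ x) (⊕-0⊙ v p)

⊕⊙e-+ : ∀ {n} (v : Vec ℕ n) a b i → v ⊕ ((a + b) ⊙ e i) ≡ (v ⊕ (a ⊙ e i)) ⊕ (b ⊙ e i)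
⊕⊙e-+ v a b i = lookup-ext λ j → begin
    lookup (v ⊕ ((a + b) ⊙ e i)) j             ≡⟨ lookup-⊕⊙e v (a + b) i j ⟩
    lookup v j + (a + b) * kron i j            ≡⟨ cong (lookup v j +_) (*-distribʳ-+ (kron i j) a b) ⟩
    lookup v j + (a * kron i j + b * kron i j) ≡⟨ sym (+-assoc (lookup v j) _ _) ⟩
    lookup v j + a * kron i j + b * kron i j   ≡⟨ cong (_+ b * kron i j) (sym (lookup-⊕⊙e v a i j)) ⟩
    lookup (v ⊕ (a ⊙ e i)) j + b * kron i j    ≡⟨ sym (lookup-⊕⊙e (v ⊕ (a ⊙ e i)) b i j) ⟩
    lookup ((v ⊕ (a ⊙ e i)) ⊕ (b ⊙ e i)) j ∎
  where open ≡-Reasoning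

≤-⊕⊙e : ∀ {n} (v : Vec ℕ n) c i j → lookup v j ≤ lookup (v ⊕ (c ⊙ e i)) j
≤-⊕⊙e v c i j = subst (lookup v j ≤_) (sym (lookup-⊕⊙e v c i j)) (m≤m+n _ _)

lookup-⊕⊙e-self : ∀ {ℓ} (u : Vec ℕ ℓ) c i → lookup (u ⊕ (c ⊙ e i)) i ≡ lookup u i + c
lookup-⊕⊙e-self u c i =
  trans (lookup-⊕⊙e u c i i) (cong (lookup u i +_) (trans (cong (c *_) (kron-refl i)) (*-identityʳ c)))

⊙-⊙ : ∀ {n} k c (p : Vec ℕ n) → k ⊙ (c ⊙ p) ≡ (k * c) ⊙ p
⊙-⊙ k c [] = refl
⊙-⊙ k c (x ∷ p) = cong₂ _∷_ (sym (*-assoc k c x)) (⊙-⊙ k c p)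

⊙e-fs : ∀ {n} c (i : Fin n) → c ⊙ e (fs i) ≡ 0 ∷ (c ⊙ e i)
⊙e-fs c i = cong₂ _∷_ (*-zeroʳ c) (cong (Vec.map (c *_)) (VecP.tabulate-cong (kron-suc i)))

_∸ᵛ_ : ∀ {n} → Vec ℕ n → Vec ℕ n → Vec ℕ n
_∸ᵛ_ = zipWith _∸_

⊕-∸ᵛ : ∀ {n} (u w : Vec ℕ n) → (u ⊕ w) ∸ᵛ w ≡ u
⊕-∸ᵛ [] [] = refl
⊕-∸ᵛ (x ∷ u) (y ∷ w) = cong₂ _∷_ (m+n∸n≡m x y) (⊕-∸ᵛ u w)

⊕-swap : ∀ {n} (a b c : Vec ℕ n) → (a ⊕ b) ⊕ c ≡ (a ⊕ c) ⊕ b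
⊕-swap [] [] [] = refl
⊕-swap (x ∷ a) (y ∷ b) (z ∷ c) = cong₂ _∷_ (xy∙z≈xz∙y x y z) (⊕-swap a b c)

⊕-cancelʳ : ∀ {n} (a b c : Vec ℕ n) → a ⊕ c ≡ b ⊕ c → a ≡ b
⊕-cancelʳ [] [] [] _ = refl
⊕-cancelʳ (x ∷ a) (y ∷ b) (z ∷ c) eq =
  cong₂ _∷_ (+-cancelʳ-≡ z x y (cong Vec.head eq)) (⊕-cancelʳ a b c (cong Vec.tail eq))

⊕⊙e-split : ∀ {n} (u : Vec ℕ n) P i → P ≤ lookup u i → Σ (Vec ℕ n) λ u′ → u ≡ u′ ⊕ (P ⊙ e i)
⊕⊙e-split (x ∷ u) P fz P≤x = (x ∸ P) ∷ u , sym (trans (⊕⊙e-fz (x ∸ P) u P) (cong (_∷ u) (m∸n+n≡m P≤x)))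
⊕⊙e-split (x ∷ u) P (fs i) P≤ui with ⊕⊙e-split u P i P≤ui
... | u′ , refl = x ∷ u′ , sym (⊕⊙e-fs x u′ P i)

sum-⊕ : ∀ {n} (u w : Vec ℕ n) → Vec.sum (u ⊕ w) ≡ Vec.sum u + Vec.sum w
sum-⊕ [] [] = refl
sum-⊕ (x ∷ u) (y ∷ w) = trans (cong (x + y +_) (sum-⊕ u w)) (interchange x y (Vec.sum u) (Vec.sum w))

sum-⊙ : ∀ {n} c (p : Vec ℕ n) → Vec.sum (c ⊙ p) ≡ c * Vec.sum p
sum-⊙ c [] = sym (*-zeroʳ c)
sum-⊙ c (x ∷ p) = trans (cong (c * x +_) (sum-⊙ c p)) (sym (*-distribˡ-+ c x (Vec.sum p)))

sum-⊙e : ∀ {n} c (i : Fin n) → Vec.sum (c ⊙ e i) ≡ c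
sum-⊙e c i = trans (sum-⊙ c (e i)) (trans (cong (c *_) (sum-e i)) (*-identityʳ c))
  where
  sum-zeros : ∀ n → Vec.sum (Vec.tabulate {n = n} (λ _ → 0)) ≡ 0
  sum-zeros zero = refl
  sum-zeros (suc n) = sum-zeros n
  sum-e : ∀ {n} (i : Fin n) → Vec.sum (e i) ≡ 1
  sum-e {suc n} fz = cong suc (sum-zeros n)
  sum-e {suc n} (fs i) = trans (cong Vec.sum (VecP.tabulate-cong (kron-suc i))) (sum-e i)

lookup≤sum : ∀ {n} (v : Vec ℕ n) j → lookup v j ≤ Vec.sum v
lookup≤sum (x ∷ v) fz = m≤m+n x (Vec.sum v)
lookup≤sum (x ∷ v) (fs j) = ≤-trans (lookup≤sum v j) (m≤n+m (Vec.sum v) x)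

allVecs : ∀ B n → List (Vec (Fin B) n)
allVecs B zero = [] ∷ []
allVecs B (suc n) = List.map (uncurry _∷_) (List.cartesianProduct (List.allFin B) (allVecs B n))

allVecs-complete : ∀ B {n} (c : Vec (Fin B) n) → c ∈ allVecs B n
allVecs-complete B [] = here refl
allVecs-complete B (x ∷ c) = ∈-map⁺ (uncurry _∷_) (∈-cartesianProduct⁺ (∈-allFin x) (allVecs-complete B c))

blockWord-cons : ∀ {ℓ} x (u : Vec ℕ ℓ) → blockWord (x ∷ u) ≡ replicate x fz ++ List.map fs (blockWord u)
blockWord-cons x u = cong (replicate x fz ++_) (begin
    concat (Vec.toList (zipWith replicate u (tabulate fs)))
      ≡⟨ cong (concat ∘ Vec.toList) (shift u id) ⟩
    concat (Vec.toList (Vec.map (List.map fs) (zipWith replicate u (tabulate id))))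
      ≡⟨ cong concat (VecP.toList-map (List.map fs) (zipWith replicate u (tabulate id))) ⟩
    concat (List.map (List.map fs) (Vec.toList (zipWith replicate u (tabulate id))))
      ≡⟨ ListP.concat-map (Vec.toList (zipWith replicate u (tabulate id))) ⟩
    List.map fs (blockWord u) ∎)
  where
  open ≡-Reasoning
  shift : ∀ {n m} (u : Vec ℕ n) (f : Fin n → Fin m) →
          zipWith replicate u (tabulate (fs ∘ f)) ≡ Vec.map (List.map fs) (zipWith replicate u (tabulate f))
  shift [] f = refl
  shift (x ∷ u) f = cong₂ _∷_ (sym (ListP.map-replicate fs x (f fz))) (shift u (f ∘ fs))

occ-++ : ∀ {ℓ} (i : Fin ℓ) xs ys → occ i (xs ++ ys) ≡ occ i xs + occ i ys
occ-++ i [] ys = refl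
occ-++ i (x ∷ xs) ys = trans (cong (kron i x +_) (occ-++ i xs ys)) (sym (+-assoc (kron i x) (occ i xs) _))

occ-replicate : ∀ {ℓ} (i a : Fin ℓ) x → occ i (replicate x a) ≡ x * kron i a
occ-replicate i a zero = refl
occ-replicate i a (suc x) = cong (kron i a +_) (occ-replicate i a x)

occ-map-zero : ∀ {ℓ} (w : Word ℓ) → occ fz (List.map fs w) ≡ 0
occ-map-zero [] = refl
occ-map-zero (x ∷ w) = occ-map-zero w

occ-map-suc : ∀ {ℓ} (i : Fin ℓ) (w : Word ℓ) → occ (fs i) (List.map fs w) ≡ occ i w
occ-map-suc i [] = refl
occ-map-suc i (x ∷ w) = cong₂ _+_ (kron-suc i x) (occ-map-suc i w)

lookup-Ψ : ∀ {ℓ} (w : Word ℓ) j → lookup (Ψ w) j ≡ occ j w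
lookup-Ψ w j = VecP.lookup∘tabulate _ j

Ψ-map-suc : ∀ {ℓ} (w : Word ℓ) → Ψ (List.map fs w) ≡ 0 ∷ Ψ w
Ψ-map-suc w = cong₂ _∷_ (occ-map-zero w) (VecP.tabulate-cong (λ i → occ-map-suc i w))

occ-blockWord : ∀ {ℓ} (k : Vec ℕ ℓ) i → occ i (blockWord k) ≡ lookup k i
occ-blockWord (x ∷ u) i = begin
    occ i (blockWord (x ∷ u))                                  ≡⟨ cong (occ i) (blockWord-cons x u) ⟩
    occ i (replicate x fz ++ List.map fs (blockWord u))        ≡⟨ occ-++ i (replicate x fz) _ ⟩
    occ i (replicate x fz) + occ i (List.map fs (blockWord u)) ≡⟨ cong (_+ _) (occ-replicate i fz x) ⟩
    x * kron i fz + occ i (List.map fs (blockWord u))          ≡⟨ split i ⟩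
    lookup (x ∷ u) i ∎
  where
  open ≡-Reasoning
  split : ∀ i → x * kron i fz + occ i (List.map fs (blockWord u)) ≡ lookup (x ∷ u) i
  split fz = trans (cong₂ _+_ (*-identityʳ x) (occ-map-zero (blockWord u))) (+-identityʳ x)
  split (fs i) = trans (cong (_+ occ (fs i) (List.map fs (blockWord u))) (*-zeroʳ x)) (trans (occ-map-suc i (blockWord u)) (occ-blockWord u i))

Ψ-blockWord : ∀ {ℓ} (k : Vec ℕ ℓ) → Ψ (blockWord k) ≡ k
Ψ-blockWord k = lookup-ext λ j → trans (lookup-Ψ (blockWord k) j) (occ-blockWord k j)

InB⇒blockWord-Ψ : ∀ {ℓ} {w : Word ℓ} → InB ℓ w → w ≡ blockWord (Ψ w)
InB⇒blockWord-Ψ (k , refl) = cong blockWord (sym (Ψ-blockWord k))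

blockWord-zero : ∀ {ℓ} → blockWord {ℓ} (tabulate (λ _ → 0)) ≡ []
blockWord-zero {zero} = refl
blockWord-zero {suc ℓ} = trans (blockWord-cons 0 (tabulate (λ _ → 0))) (cong (List.map fs) (blockWord-zero {ℓ}))

-- Membership in B_ℓ is sortedness
-- (blockWord-sorted, sorted⇒blockWord-Ψ), which a finite automaton can check.
_≤ᶠ_ : ∀ {n} → Fin n → Fin n → Bool
fz ≤ᶠ _ = true
fs _ ≤ᶠ fz = false
fs a ≤ᶠ fs b = a ≤ᶠ b

≤ᶠ-refl : ∀ {n} (a : Fin n) → (a ≤ᶠ a) ≡ true
≤ᶠ-refl fz = refl
≤ᶠ-refl (fs a) = ≤ᶠ-refl a

≤ᶠ-trans : ∀ {n} (a b c : Fin n) → (a ≤ᶠ b) ≡ true → (b ≤ᶠ c) ≡ true → (a ≤ᶠ c) ≡ true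
≤ᶠ-trans fz b c _ _ = refl
≤ᶠ-trans (fs a) (fs b) (fs c) p q = ≤ᶠ-trans a b c p q

sortedFrom : ∀ {ℓ} → Fin ℓ → Word ℓ → Bool
sortedFrom a [] = true
sortedFrom a (b ∷ w) = (a ≤ᶠ b) ∧ sortedFrom b w

sorted-map : ∀ {ℓ} (a : Fin ℓ) (w : Word ℓ) → sortedFrom (fs a) (List.map fs w) ≡ sortedFrom a w
sorted-map a [] = refl
sorted-map a (b ∷ w) = cong ((a ≤ᶠ b) ∧_) (sorted-map b w)

sorted-weaken : ∀ {ℓ} (a b : Fin ℓ) w → (a ≤ᶠ b) ≡ true → sortedFrom b w ≡ true → sortedFrom a w ≡ true
sorted-weaken a b [] _ _ = refl
sorted-weaken a b (c ∷ w) a≤b p with ∧-true {b ≤ᶠ c} p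
... | b≤c , q = cong₂ _∧_ (≤ᶠ-trans a b c a≤b b≤c) q

sorted-replicate : ∀ {ℓ} (a : Fin ℓ) x v → sortedFrom a v ≡ true → sortedFrom a (replicate x a ++ v) ≡ true
sorted-replicate a zero v p = p
sorted-replicate a (suc x) v p = cong₂ _∧_ (≤ᶠ-refl a) (sorted-replicate a x v p)

blockWord-sorted : ∀ {ℓ} (k : Vec ℕ (suc ℓ)) → sortedFrom fz (blockWord k) ≡ true
blockWord-sorted (x ∷ []) = trans (cong (sortedFrom fz) (blockWord-cons x [])) (sorted-replicate fz x [] refl)
blockWord-sorted (x ∷ y ∷ u) =
  trans (cong (sortedFrom fz) (blockWord-cons x (y ∷ u)))
        (sorted-replicate fz x _ (sorted-weaken fz (fs fz) (List.map fs (blockWord (y ∷ u))) refl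
          (trans (sorted-map fz (blockWord (y ∷ u))) (blockWord-sorted (y ∷ u)))))

sorted-unshift : ∀ {ℓ} (a : Fin ℓ) (w : Word (suc ℓ)) → sortedFrom (fs a) w ≡ true →
                 Σ (Word ℓ) λ v → (w ≡ List.map fs v) × (sortedFrom a v ≡ true)
sorted-unshift a [] p = [] , refl , refl
sorted-unshift a (fz ∷ w) ()
sorted-unshift a (fs b ∷ w) p with ∧-true {a ≤ᶠ b} p
... | a≤b , q with sorted-unshift b w q
... | v , refl , r = (b ∷ v) , refl , cong₂ _∧_ a≤b r

sorted⇒blockWord-Ψ : ∀ {ℓ} (w : Word (suc ℓ)) → sortedFrom fz w ≡ true → w ≡ blockWord (Ψ w)
sorted⇒blockWord-Ψ [] p = sym blockWord-zero
sorted⇒blockWord-Ψ {ℓ} (fz ∷ w) p = begin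
    fz ∷ w                                                          ≡⟨ cong (fz ∷_) (sorted⇒blockWord-Ψ w p) ⟩
    fz ∷ blockWord (occ fz w ∷ tail)                                ≡⟨ cong (fz ∷_) (blockWord-cons (occ fz w) tail) ⟩
    fz ∷ (replicate (occ fz w) fz ++ List.map fs (blockWord tail))  ≡⟨ sym (blockWord-cons (suc (occ fz w)) tail) ⟩
    blockWord (Ψ (fz ∷ w)) ∎
  where
  open ≡-Reasoning
  tail : Vec ℕ ℓ
  tail = tabulate (λ i → occ (fs i) w)
sorted⇒blockWord-Ψ {suc ℓ} (fs a ∷ w) p with sorted-unshift a w p
... | v , refl , q = begin
    List.map fs (a ∷ v)                  ≡⟨ cong (List.map fs) (sorted⇒blockWord-Ψ (a ∷ v) q) ⟩
    List.map fs (blockWord (Ψ (a ∷ v)))  ≡⟨ sym (blockWord-cons 0 (Ψ (a ∷ v))) ⟩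
    blockWord (0 ∷ Ψ (a ∷ v))            ≡⟨ cong blockWord (sym (Ψ-map-suc (a ∷ v))) ⟩
    blockWord (Ψ (List.map fs (a ∷ v)))  ∎
  where open ≡-Reasoning

runWith : ∀ {S : Set} {ℓ} → (S → Fin ℓ → S) → S → Word ℓ → S
runWith δ q [] = q
runWith δ q (a ∷ w) = runWith δ (δ q a) w

run≡runWith : ∀ {ℓ} (D : DFA ℓ) q w → run D q w ≡ runWith (DFA.δ D) q w
run≡runWith D q [] = refl
run≡runWith D q (a ∷ w) = run≡runWith D (DFA.δ D q a) w

runWith-++ : ∀ {S : Set} {ℓ} (δ : S → Fin ℓ → S) q xs ys → runWith δ q (xs ++ ys) ≡ runWith δ (runWith δ q xs) ys
runWith-++ δ q [] ys = refl
runWith-++ δ q (x ∷ xs) ys = runWith-++ δ (δ q x) xs ys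

runWith-map-suc : ∀ {S : Set} {ℓ} (δ : S → Fin (suc ℓ) → S) q w →
                  runWith δ q (List.map fs w) ≡ runWith (λ s a → δ s (fs a)) q w
runWith-map-suc δ q [] = refl
runWith-map-suc δ q (a ∷ w) = runWith-map-suc δ (δ q (fs a)) w

fold-shift : ∀ {S : Set} (g : S → S) q n → fold (g q) g n ≡ g (fold q g n)
fold-shift g q zero = refl
fold-shift g q (suc n) = cong g (fold-shift g q n)

runWith-replicate : ∀ {S : Set} {ℓ} (δ : S → Fin ℓ → S) q k a → runWith δ q (replicate k a) ≡ fold q (λ s → δ s a) k
runWith-replicate δ q zero a = refl
runWith-replicate δ q (suc k) a = trans (runWith-replicate δ (δ q a) k a) (fold-shift (λ s → δ s a) q k)

fold-cycle : ∀ {S : Set} (g : S → S) q a d → fold q g (a + d) ≡ fold q g a →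
             ∀ m k → a ≤ k → fold q g (k + m * d) ≡ fold q g k
fold-cycle g q a d cyc zero k a≤k = cong (fold q g) (+-identityʳ k)
fold-cycle g q a d cyc (suc m) k a≤k = begin
    fold q g (k + (d + m * d))              ≡⟨ cong (fold q g) reassoc ⟩
    fold q g ((k + m * d ∸ a) + (a + d))    ≡⟨ fold-+ q g (k + m * d ∸ a) ⟩
    fold (fold q g (a + d)) g (k + m * d ∸ a) ≡⟨ cong (λ s → fold s g (k + m * d ∸ a)) cyc ⟩
    fold (fold q g a) g (k + m * d ∸ a)     ≡⟨ sym (fold-+ q g (k + m * d ∸ a)) ⟩
    fold q g ((k + m * d ∸ a) + a)          ≡⟨ cong (fold q g) (m∸n+n≡m a≤k+md) ⟩
    fold q g (k + m * d)                    ≡⟨ fold-cycle g q a d cyc m k a≤k ⟩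
    fold q g k ∎
  where
  open ≡-Reasoning
  a≤k+md : a ≤ k + m * d
  a≤k+md = ≤-trans a≤k (m≤m+n k (m * d))
  reassoc : k + (d + m * d) ≡ (k + m * d ∸ a) + (a + d)
  reassoc = begin
    k + (d + m * d)            ≡⟨ cong (k +_) (+-comm d (m * d)) ⟩
    k + (m * d + d)            ≡⟨ sym (+-assoc k (m * d) d) ⟩
    k + m * d + d              ≡⟨ cong (_+ d) (sym (m∸n+n≡m a≤k+md)) ⟩
    (k + m * d ∸ a) + a + d    ≡⟨ +-assoc (k + m * d ∸ a) a d ⟩
    (k + m * d ∸ a) + (a + d)  ∎

∣n! : ∀ {d n} → 0 < d → d ≤ n → d ∣ n !
∣n! {suc d'} _ d≤n = ∣-trans (m∣m*n (d' !)) (m≤n⇒m!∣n! d≤n)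

-- Pigeonhole: the orbit of any point under a self-map of an N-element set is
-- periodic from step N on, and N! is a period.
fold-eventually-periodic : ∀ {N} (g : Fin N → Fin N) q k → N ≤ k → fold q g (k + N !) ≡ fold q g k
fold-eventually-periodic {N} g q k N≤k with FinP.pigeonhole (n<1+n N) (λ t → fold q g (toℕ t))
... | i , j , i<j , orbit-i≡orbit-j
    with ∣n! (m<n⇒0<n∸m i<j) (≤-trans (m∸n≤m (toℕ j) (toℕ i)) (FinP.toℕ≤pred[n] j))
... | divides m N!≡m*d = trans (cong (λ p → fold q g (k + p)) N!≡m*d)
                           (fold-cycle g q (toℕ i) (toℕ j ∸ toℕ i) cycle m k i≤k)
  where
  i≤j : toℕ i ≤ toℕ j
  i≤j = <⇒≤ i<j
  i≤k : toℕ i ≤ k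
  i≤k = ≤-trans (≤-trans i≤j (FinP.toℕ≤pred[n] j)) N≤k
  cycle : fold q g (toℕ i + (toℕ j ∸ toℕ i)) ≡ fold q g (toℕ i)
  cycle = trans (cong (fold q g) (m+[n∸m]≡n i≤j)) (sym orbit-i≡orbit-j)

Periodic : ∀ {ℓ} → ℕ → ℕ → (Vec ℕ ℓ → Set) → Set
Periodic {ℓ} T P Z = ∀ (v : Vec ℕ ℓ) i → T ≤ lookup v i → Z v ⇔ Z (v ⊕ (P ⊙ e i))

periodic-multiple : ∀ {ℓ T P} {Z : Vec ℕ ℓ → Set} → Periodic T P Z →
                    ∀ v i → T ≤ lookup v i → ∀ m → Z v ⇔ Z (v ⊕ ((m * P) ⊙ e i))
periodic-multiple {Z = Z} per v i T≤vi zero = ⇔-cong Z (sym (⊕-0⊙ v (e i)))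
periodic-multiple {P = P} {Z} per v i T≤vi (suc m) = begin
    Z v                                    ≈⟨ periodic-multiple per v i T≤vi m ⟩
    Z (v ⊕ ((m * P) ⊙ e i))                ≈⟨ per _ i (≤-trans T≤vi (≤-⊕⊙e v (m * P) i i)) ⟩
    Z ((v ⊕ ((m * P) ⊙ e i)) ⊕ (P ⊙ e i))  ≡⟨ cong Z (sym (⊕⊙e-+ v (m * P) P i)) ⟩
    Z (v ⊕ ((m * P + P) ⊙ e i))            ≡⟨ cong (λ c → Z (v ⊕ (c ⊙ e i))) (+-comm (m * P) P) ⟩
    Z (v ⊕ ((suc m * P) ⊙ e i))            ∎
  where open ⇔-Reasoning

periodic-tail : ∀ {ℓ T P} {Z : Vec ℕ (suc ℓ) → Set} → Periodic T P Z → ∀ y → Periodic T P (λ u → Z (y ∷ u))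
periodic-tail {P = P} {Z} per y u i T≤ui = ⇔-trans (per (y ∷ u) (fs i) T≤ui) (⇔-cong Z (⊕⊙e-fs y u P i))

periodic-raise : ∀ {ℓ T T′ P} {Z : Vec ℕ ℓ → Set} → T ≤ T′ → Periodic T P Z → Periodic T′ P Z
periodic-raise T≤T′ per v i T′≤vi = per v i (≤-trans T≤T′ T′≤vi)

periodic-⇔ : ∀ {ℓ T P} {Z Z′ : Vec ℕ ℓ → Set} → (∀ v → Z v ⇔ Z′ v) → Periodic T P Z′ → Periodic T P Z
periodic-⇔ {P = P} Z⇔Z′ per v i T≤vi = ⇔-trans (Z⇔Z′ v) (⇔-trans (per v i T≤vi) (⇔-sym (Z⇔Z′ (v ⊕ (P ⊙ e i)))))

-- Reduction modulo threshold T and period P = 1 + P': every n is represented by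
-- a residue in {0, …, T + P - 1}, computed by a finite counter 'step' that a
-- DFA can run letter by letter.
module Reduction (T P' : ℕ) where
  P : ℕ
  P = suc P'

  B : ℕ
  B = suc (T + P')

  T<B : T < B
  T<B = s≤s (m≤m+n T P')

  step : Fin B → Fin B
  step x with suc (toℕ x) ℕ.<? B
  ... | yes x+1<B = fromℕ< x+1<B
  ... | no _      = fromℕ< T<B

  reduce : ℕ → Fin B
  reduce n = fold fz step n

  R : ℕ → ℕ
  R n = toℕ (reduce n)

  Decomposition : ℕ → ℕ → Set
  Decomposition n r = Σ ℕ λ m → (n ≡ r + m * P) × ((m ≡ 0) ⊎ (T ≤ r))

  step-decomposition : ∀ n x → Decomposition n (toℕ x) → Decomposition (suc n) (toℕ (step x))
  step-decomposition n x (m , n≡ , side) with suc (toℕ x) ℕ.<? B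
  ... | yes x+1<B = m , trans (cong suc n≡) (cong (_+ m * P) (sym (FinP.toℕ-fromℕ< x+1<B))) , side′ side
    where
    side′ : (m ≡ 0) ⊎ (T ≤ toℕ x) → (m ≡ 0) ⊎ (T ≤ toℕ (fromℕ< x+1<B))
    side′ (inj₁ m≡0) = inj₁ m≡0
    side′ (inj₂ T≤x) = inj₂ (subst (T ≤_) (sym (FinP.toℕ-fromℕ< x+1<B)) (≤-trans T≤x (n≤1+n _)))
  ... | no x+1≮B = suc m , wrap , inj₂ (subst (T ≤_) (sym (FinP.toℕ-fromℕ< T<B)) ≤-refl)
    where
    open ≡-Reasoning
    x+1≡T+P : suc (toℕ x) ≡ T + P
    x+1≡T+P = trans (≤-antisym (FinP.toℕ<n x) (≮⇒≥ x+1≮B)) (sym (+-suc T P'))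
    wrap : suc n ≡ toℕ (fromℕ< T<B) + suc m * P
    wrap = begin
      suc n                         ≡⟨ cong suc n≡ ⟩
      suc (toℕ x) + m * P           ≡⟨ cong (_+ m * P) x+1≡T+P ⟩
      T + P + m * P                 ≡⟨ +-assoc T P (m * P) ⟩
      T + suc m * P                 ≡⟨ cong (_+ suc m * P) (sym (FinP.toℕ-fromℕ< T<B)) ⟩
      toℕ (fromℕ< T<B) + suc m * P  ∎

  reduce-decomposition : ∀ n → Decomposition n (R n)
  reduce-decomposition zero = 0 , refl , inj₁ refl
  reduce-decomposition (suc n) = step-decomposition n (reduce n) (reduce-decomposition n)

  periodic-reduce : ∀ {n} {Z : Vec ℕ n → Set} → Periodic T P Z → ∀ v → Z v ⇔ Z (Vec.map R v)
  periodic-reduce per [] = ⇔-refl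
  periodic-reduce {Z = Z} per (x ∷ u) with reduce-decomposition x
  ... | m , x≡ , side = begin
      Z (x ∷ u)                ≡⟨ cong (λ y → Z (y ∷ u)) x≡ ⟩
      Z ((R x + m * P) ∷ u)    ≈⟨ reduce-head side ⟨
      Z (R x ∷ u)              ≈⟨ periodic-reduce (periodic-tail {P = P} per (R x)) u ⟩
      Z (R x ∷ Vec.map R u)    ∎
    where
    open ⇔-Reasoning
    reduce-head : (m ≡ 0) ⊎ (T ≤ R x) → Z (R x ∷ u) ⇔ Z ((R x + m * P) ∷ u)
    reduce-head (inj₁ refl) = ⇔-cong (λ y → Z (y ∷ u)) (sym (+-identityʳ (R x)))
    reduce-head (inj₂ T≤Rx) = ⇔-trans (periodic-multiple per (R x ∷ u) fz T≤Rx m) (⇔-cong Z (⊕⊙e-fz (R x) u (m * P)))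

blockWord-pump : ∀ {N ℓ} (δ : Fin N → Fin ℓ → Fin N) q (v : Vec ℕ ℓ) i → N ≤ lookup v i →
                 runWith δ q (blockWord (v ⊕ ((N !) ⊙ e i))) ≡ runWith δ q (blockWord v)
blockWord-pump {N} {suc ℓ} δ q (x ∷ u) fz N≤x = begin
    runWith δ q (blockWord ((x ∷ u) ⊕ ((N !) ⊙ e fz)))       ≡⟨ cong (runWith δ q ∘ blockWord) (⊕⊙e-fz x u (N !)) ⟩
    runWith δ q (blockWord ((x + N !) ∷ u))                   ≡⟨ reading (x + N !) ⟩
    runWith δ (fold q (λ s → δ s fz) (x + N !)) rest          ≡⟨ cong (λ s → runWith δ s rest) (fold-eventually-periodic (λ s → δ s fz) q x N≤x) ⟩
    runWith δ (fold q (λ s → δ s fz) x) rest                  ≡⟨ sym (reading x) ⟩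
    runWith δ q (blockWord (x ∷ u)) ∎
  where
  open ≡-Reasoning
  rest : Word (suc ℓ)
  rest = List.map fs (blockWord u)
  reading : ∀ y → runWith δ q (blockWord (y ∷ u)) ≡ runWith δ (fold q (λ s → δ s fz) y) rest
  reading y = trans (cong (runWith δ q) (blockWord-cons y u))
                (trans (runWith-++ δ q (replicate y fz) rest)
                  (cong (λ s → runWith δ s rest) (runWith-replicate δ q y fz)))
blockWord-pump {N} {suc ℓ} δ q (x ∷ u) (fs i) N≤ui = begin
    runWith δ q (blockWord ((x ∷ u) ⊕ ((N !) ⊙ e (fs i))))   ≡⟨ cong (runWith δ q ∘ blockWord) (⊕⊙e-fs x u (N !) i) ⟩
    runWith δ q (blockWord (x ∷ (u ⊕ ((N !) ⊙ e i))))         ≡⟨ reading (u ⊕ ((N !) ⊙ e i)) ⟩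
    runWith δ' q' (blockWord (u ⊕ ((N !) ⊙ e i)))             ≡⟨ blockWord-pump δ' q' u i N≤ui ⟩
    runWith δ' q' (blockWord u)                               ≡⟨ sym (reading u) ⟩
    runWith δ q (blockWord (x ∷ u)) ∎
  where
  open ≡-Reasoning
  q' : Fin N
  q' = runWith δ q (replicate x fz)
  δ' : Fin N → Fin ℓ → Fin N
  δ' s a = δ s (fs a)
  reading : ∀ w → runWith δ q (blockWord (x ∷ w)) ≡ runWith δ' q' (blockWord w)
  reading w = trans (cong (runWith δ q) (blockWord-cons x w))
                (trans (runWith-++ δ q (replicate x fz) (List.map fs (blockWord w)))
                  (runWith-map-suc δ q' (blockWord w)))

acceptedBlocks : ∀ {ℓ} → DFA ℓ → Vec ℕ ℓ → Set
acceptedBlocks D v = accepts D (blockWord v) ≡ true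

acceptedBlocks-periodic : ∀ {ℓ} (D : DFA ℓ) → Periodic (DFA.nStates D) (DFA.nStates D !) (acceptedBlocks D)
acceptedBlocks-periodic D v i N≤vi = mk⇔ (trans same-state) (trans (sym same-state))
  where
  same-state : accepts D (blockWord (v ⊕ ((DFA.nStates D !) ⊙ e i))) ≡ accepts D (blockWord v)
  same-state = cong (DFA.final D)
    (trans (run≡runWith D (DFA.start D) (blockWord (v ⊕ ((DFA.nStates D !) ⊙ e i))))
      (trans (blockWord-pump (DFA.δ D) (DFA.start D) v i N≤vi) (sym (run≡runWith D (DFA.start D) (blockWord v)))))

InLinearPres : ∀ {ℓ} → LinPres ℓ → Vec ℕ ℓ → Set
InLinearPres L v = InLinear (proj₁ L) (proj₂ L) v

AnyLinear : ∀ {ℓ} → List (LinPres ℓ) → Vec ℕ ℓ → Set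
AnyLinear Ls v = Any (λ L → InLinearPres L v) Ls

InLinear-cons : ∀ {n} x (r : Vec ℕ n) ps v → InLinear r ps v → InLinear (x ∷ r) (List.map (0 ∷_) ps) (x ∷ v)
InLinear-cons x r [] v refl = refl
InLinear-cons x r (p ∷ ps) v (k , u , lin , refl) =
  k , x ∷ u , InLinear-cons x r ps u lin , cong (_∷ _) (sym (trans (cong (x +_) (*-zeroʳ k)) (+-identityʳ x)))

canonical-member : ∀ {ℓ} (r : Vec ℕ ℓ) (c m : Fin ℓ → ℕ) →
                   InLinear r (List.tabulate (λ i → c i ⊙ e i)) (r ⊕ tabulate (λ i → m i * c i))
canonical-member [] c m = refl
canonical-member {suc ℓ} (x ∷ r) c m = m fz , x ∷ rest , shifted , sym head-step
  where
  rest : Vec ℕ ℓ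
  rest = r ⊕ tabulate (λ i → m (fs i) * c (fs i))
  periods-fs : List.tabulate (λ i → c (fs i) ⊙ e (fs i)) ≡ List.map (0 ∷_) (List.tabulate (λ i → c (fs i) ⊙ e i))
  periods-fs = trans (ListP.tabulate-cong (λ i → ⊙e-fs (c (fs i)) i)) (sym (ListP.map-tabulate _ (0 ∷_)))
  shifted : InLinear (x ∷ r) (List.tabulate (λ i → c (fs i) ⊙ e (fs i))) (x ∷ rest)
  shifted = subst (λ ps → InLinear (x ∷ r) ps (x ∷ rest)) (sym periods-fs)
              (InLinear-cons x r _ rest (canonical-member r (λ i → c (fs i)) (λ i → m (fs i))))
  head-step : (x ∷ rest) ⊕ (m fz ⊙ (c fz ⊙ e fz)) ≡ (x + m fz * c fz) ∷ rest
  head-step = trans (cong ((x ∷ rest) ⊕_) (⊙-⊙ (m fz) (c fz) (e fz))) (⊕⊙e-fz x rest (m fz * c fz))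

Admissible : ∀ {ℓ} → ℕ → ℕ → Vec ℕ ℓ → Vec ℕ ℓ → Set
Admissible {ℓ} T P r p = Σ (Fin ℓ) λ i → Σ ℕ λ c → (p ≡ c ⊙ e i) × ((c ≡ 0) ⊎ ((c ≡ P) × (T ≤ lookup r i)))

periodic-closed : ∀ {ℓ T P} {Z : Vec ℕ ℓ → Set} → Periodic T P Z → ∀ r ps v → Z r →
                  All (Admissible T P r) ps → InLinear r ps v → Z v × (∀ j → lookup r j ≤ lookup v j)
periodic-closed per r [] v zr [] refl = zr , λ j → ≤-refl
periodic-closed {T = T} {P} {Z} per r (p ∷ ps) v zr ((i , c , refl , side) ∷ adm) (k , u , lin , refl)
  with periodic-closed per r ps u zr adm lin
... | zu , r≤u = subst Z (sym v≡) (add side) , λ j →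
  subst (lookup r j ≤_) (sym (cong (λ w → lookup w j) v≡)) (≤-trans (r≤u j) (≤-⊕⊙e u (k * c) i j))
  where
  v≡ : u ⊕ (k ⊙ (c ⊙ e i)) ≡ u ⊕ ((k * c) ⊙ e i)
  v≡ = cong (u ⊕_) (⊙-⊙ k c (e i))
  add : (c ≡ 0) ⊎ ((c ≡ P) × (T ≤ lookup r i)) → Z (u ⊕ ((k * c) ⊙ e i))
  add (inj₁ refl) = subst Z (sym (trans (cong (λ d → u ⊕ (d ⊙ e i)) (*-zeroʳ k)) (⊕-0⊙ u (e i)))) zu
  add (inj₂ (refl , T≤ri)) = Equivalence.to (periodic-multiple per u i (≤-trans T≤ri (r≤u i)) k) zu

-- A decidable periodic set is semi-linear with canonical periods: it is the
-- union, over the residue vectors r it contains, of the linear sets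
-- r + Σ_i ℕ q_i e_i, where q_i = P if r_i ≥ T and q_i = 0 otherwise.
module Periodic⇒SemiLinear (T P' : ℕ) {ℓ} (Z : Vec ℕ ℓ → Set)
                           (per : Periodic T (suc P') Z) (Z? : Decidable Z) where
  open Reduction T P'

  period : Vec ℕ ℓ → Fin ℓ → ℕ
  period r i with T ≤? lookup r i
  ... | yes _ = P
  ... | no _ = 0

  period-admissible : ∀ r i → (period r i ≡ 0) ⊎ ((period r i ≡ P) × (T ≤ lookup r i))
  period-admissible r i with T ≤? lookup r i
  ... | yes T≤ri = inj₂ (refl , T≤ri)
  ... | no _ = inj₁ refl

  period-above : ∀ r i → T ≤ lookup r i → period r i ≡ P
  period-above r i T≤ri with T ≤? lookup r i
  ... | yes _ = refl
  ... | no T≰ri = ⊥-elim (T≰ri T≤ri)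

  linearAt : Vec ℕ ℓ → LinPres ℓ
  linearAt r = r , List.tabulate (λ i → period r i ⊙ e i)

  residues : List (Vec ℕ ℓ)
  residues = List.map (Vec.map toℕ) (allVecs B ℓ)

  presentation : List (LinPres ℓ)
  presentation = List.map linearAt (List.filter Z? residues)

  in-own-class : ∀ v → InLinearPres (linearAt (Vec.map R v)) v
  in-own-class v = subst (InLinearPres (linearAt r)) v≡ (canonical-member r (period r) m)
    where
    r : Vec ℕ ℓ
    r = Vec.map R v
    m : Fin ℓ → ℕ
    m i = proj₁ (reduce-decomposition (lookup v i))
    lookup-r : ∀ i → lookup r i ≡ R (lookup v i)
    lookup-r i = VecP.lookup-map i R v
    coefficient : ∀ i → m i * period r i ≡ m i * P
    coefficient i with reduce-decomposition (lookup v i)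
    ... | m′ , _ , inj₁ refl = refl
    ... | m′ , _ , inj₂ T≤R = cong (m′ *_) (period-above r i (subst (T ≤_) (sym (lookup-r i)) T≤R))
    v≡ : r ⊕ tabulate (λ i → m i * period r i) ≡ v
    v≡ = lookup-ext λ i → begin
      lookup (r ⊕ tabulate (λ i → m i * period r i)) i  ≡⟨ lookup-⊕ r _ i ⟩
      lookup r i + lookup (tabulate (λ i → m i * period r i)) i ≡⟨ cong₂ _+_ (lookup-r i) (VecP.lookup∘tabulate _ i) ⟩
      R (lookup v i) + m i * period r i                 ≡⟨ cong (R (lookup v i) +_) (coefficient i) ⟩
      R (lookup v i) + m i * P                          ≡⟨ sym (proj₁ (proj₂ (reduce-decomposition (lookup v i)))) ⟩
      lookup v i ∎
      where open ≡-Reasoning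

  -- Z v gives Z (R v) by periodicity, so v lies in the linear set at R v.
  covers : ∀ v → Z v → AnyLinear presentation v
  covers v zv = AnyP.map⁺ (lose (∈-filter⁺ Z? r∈residues zr) (in-own-class v))
    where
    r : Vec ℕ ℓ
    r = Vec.map R v
    r∈residues : r ∈ residues
    r∈residues = subst (_∈ residues) (sym (VecP.map-∘ toℕ reduce v))
                   (∈-map⁺ (Vec.map toℕ) (allVecs-complete B (Vec.map reduce v)))
    zr : Z r
    zr = Equivalence.to (periodic-reduce per v) zv

  sound : ∀ v → AnyLinear presentation v → Z v
  sound v any with find (AnyP.map⁻ any)
  ... | r , r∈ , lin = proj₁ (periodic-closed per r _ v (proj₂ (∈-filter⁻ Z? {xs = residues} r∈)) admissible lin)
    where
    admissible : All (Admissible T P r) (List.tabulate (λ i → period r i ⊙ e i))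
    admissible = AllP.tabulate⁺ (λ i → i , period r i , refl , period-admissible r i)

  semilinear : SemiLinearCanon ℓ Z
  semilinear = presentation , canonical , λ v → mk⇔ (covers v) (sound v)
    where
    canonical : All (λ L → All MultCanon (proj₂ L)) presentation
    canonical = AllP.map⁺ (All.universal (λ r → AllP.tabulate⁺ (λ i → period r i , i , refl)) (List.filter Z? residues))

periodic⇒semilinear : ∀ {ℓ T P} {Z : Vec ℕ ℓ → Set} → 0 < P → Periodic T P Z → Decidable Z → SemiLinearCanon ℓ Z
periodic⇒semilinear {T = T} {suc P'} {Z} _ per Z? = Periodic⇒SemiLinear.semilinear T P' Z per Z?

-- The coefficient of a period p in v = u + c·p may be taken to be at most Σv
-- (it can be replaced by 0 if p = 0, and otherwise c ≤ Σ(c·p) ≤ Σv).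
bounded-coefficient : ∀ {ℓ} (u p : Vec ℕ ℓ) c →
                      Σ ℕ λ c′ → (c′ ≤ Vec.sum (u ⊕ (c ⊙ p))) × (u ⊕ (c ⊙ p) ≡ u ⊕ (c′ ⊙ p))
bounded-coefficient u p c with Vec.sum p in Σp≡
... | zero = 0 , z≤n , cong (u ⊕_) (lookup-ext zero-period)
  where
  zero-period : ∀ j → lookup (c ⊙ p) j ≡ lookup (0 ⊙ p) j
  zero-period j = trans (VecP.lookup-map j (c *_) p)
    (trans (cong (c *_) (n≤0⇒n≡0 (subst (lookup p j ≤_) Σp≡ (lookup≤sum p j))))
      (trans (*-zeroʳ c) (sym (VecP.lookup-map j (0 *_) p))))
... | suc s = c , c≤Σ , refl
  where
  open ≤-Reasoning
  c≤Σ : c ≤ Vec.sum (u ⊕ (c ⊙ p))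
  c≤Σ = begin
    c                            ≤⟨ m≤m*n c (suc s) ⟩
    c * suc s                    ≡⟨ cong (c *_) Σp≡ ⟨
    c * Vec.sum p                ≡⟨ sum-⊙ c p ⟨
    Vec.sum (c ⊙ p)              ≤⟨ m≤n+m _ (Vec.sum u) ⟩
    Vec.sum u + Vec.sum (c ⊙ p)  ≡⟨ sum-⊕ u (c ⊙ p) ⟨
    Vec.sum (u ⊕ (c ⊙ p))        ∎

-- Membership in a linear set is decidable, by bounded search for the
-- coefficient of the last period: v = u + c·p forces u = v ∸ c·p.
InLinear? : ∀ {ℓ} (r : Vec ℕ ℓ) ps → Decidable (InLinear r ps)
InLinear? r [] v = VecP.≡-dec _≟_ v r
InLinear? {ℓ} r (p ∷ ps) v = map′ found bounded (anyUpTo? Q? (suc (Vec.sum v)))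
  where
  Q : ℕ → Set
  Q c = InLinear r ps (v ∸ᵛ (c ⊙ p)) × (v ≡ (v ∸ᵛ (c ⊙ p)) ⊕ (c ⊙ p))
  Q? : Decidable Q
  Q? c = InLinear? r ps (v ∸ᵛ (c ⊙ p)) ×-dec VecP.≡-dec _≟_ v ((v ∸ᵛ (c ⊙ p)) ⊕ (c ⊙ p))
  found : ∃ (λ c → c < suc (Vec.sum v) × Q c) → InLinear r (p ∷ ps) v
  found (c , _ , lin , v≡) = c , v ∸ᵛ (c ⊙ p) , lin , v≡
  witness : ∀ c u → InLinear r ps u → v ≡ u ⊕ (c ⊙ p) → Q c
  witness c u lin refl = subst (InLinear r ps) (sym (⊕-∸ᵛ u (c ⊙ p))) lin , cong (_⊕ (c ⊙ p)) (sym (⊕-∸ᵛ u (c ⊙ p)))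
  bounded : InLinear r (p ∷ ps) v → ∃ (λ c → c < suc (Vec.sum v) × Q c)
  bounded (c , u , lin , refl) with bounded-coefficient u p c
  ... | c′ , c′≤Σ , same = c′ , s≤s c′≤Σ , witness c′ u lin same

DividingPeriod : ∀ {ℓ} → ℕ → Vec ℕ ℓ → Set
DividingPeriod {ℓ} P p = Σ (Fin ℓ) λ j → Σ ℕ λ c → (p ≡ c ⊙ e j) × ((c ≡ 0) ⊎ (c ∣ P))

touches? : ∀ {ℓ P c} (j i : Fin ℓ) → (c ≡ 0) ⊎ (c ∣ P) → ((c ≡ 0) ⊎ (j ≢ i)) ⊎ ((j ≡ i) × (c ∣ P))
touches? j i (inj₁ c≡0) = inj₁ (inj₁ c≡0)
touches? j i (inj₂ c∣P) with j Fin.≟ i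
... | yes j≡i = inj₂ (j≡i , c∣P)
... | no j≢i = inj₁ (inj₂ j≢i)

lookup-untouched : ∀ {ℓ} (u : Vec ℕ ℓ) k c (j i : Fin ℓ) → (c ≡ 0) ⊎ (j ≢ i) →
                   lookup (u ⊕ (k ⊙ (c ⊙ e j))) i ≡ lookup u i
lookup-untouched u k c j i untouched = begin
    lookup (u ⊕ (k ⊙ (c ⊙ e j))) i  ≡⟨ cong (λ w → lookup (u ⊕ w) i) (⊙-⊙ k c (e j)) ⟩
    lookup (u ⊕ ((k * c) ⊙ e j)) i  ≡⟨ lookup-⊕⊙e u (k * c) j i ⟩
    lookup u i + k * c * kron j i   ≡⟨ cong (lookup u i +_) (vanishes untouched) ⟩
    lookup u i + 0                  ≡⟨ +-identityʳ (lookup u i) ⟩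
    lookup u i ∎
  where
  open ≡-Reasoning
  vanishes : (c ≡ 0) ⊎ (j ≢ i) → k * c * kron j i ≡ 0
  vanishes (inj₁ refl) = cong (_* kron j i) (*-zeroʳ k)
  vanishes (inj₂ j≢i) = trans (cong (k * c *_) (kron-≢ j≢i)) (*-zeroʳ (k * c))

absorb : ∀ {ℓ P} (u : Vec ℕ ℓ) k c d i → P ≡ d * c → (u ⊕ (k ⊙ (c ⊙ e i))) ⊕ (P ⊙ e i) ≡ u ⊕ ((k + d) ⊙ (c ⊙ e i))
absorb {P = P} u k c d i P≡dc = begin
    (u ⊕ (k ⊙ (c ⊙ e i))) ⊕ (P ⊙ e i)       ≡⟨ cong₂ (λ a b → (u ⊕ a) ⊕ (b ⊙ e i)) (⊙-⊙ k c (e i)) P≡dc ⟩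
    (u ⊕ ((k * c) ⊙ e i)) ⊕ ((d * c) ⊙ e i) ≡⟨ ⊕⊙e-+ u (k * c) (d * c) i ⟨
    u ⊕ ((k * c + d * c) ⊙ e i)             ≡⟨ cong (λ x → u ⊕ (x ⊙ e i)) (*-distribʳ-+ c k d) ⟨
    u ⊕ (((k + d) * c) ⊙ e i)               ≡⟨ cong (u ⊕_) (⊙-⊙ (k + d) c (e i)) ⟨
    u ⊕ ((k + d) ⊙ (c ⊙ e i)) ∎
  where open ≡-Reasoning

unabsorb : ∀ {ℓ P} (u v : Vec ℕ ℓ) k c d i → P ≡ d * c → d ≤ k →
           v ⊕ (P ⊙ e i) ≡ u ⊕ (k ⊙ (c ⊙ e i)) → v ≡ u ⊕ ((k ∸ d) ⊙ (c ⊙ e i))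
unabsorb {P = P} u v k c d i P≡dc d≤k sum≡ = ⊕-cancelʳ v (u ⊕ ((k ∸ d) ⊙ (c ⊙ e i))) (P ⊙ e i) (begin
    v ⊕ (P ⊙ e i)                              ≡⟨ sum≡ ⟩
    u ⊕ (k ⊙ (c ⊙ e i))                        ≡⟨ cong (λ x → u ⊕ (x ⊙ (c ⊙ e i))) (m∸n+n≡m d≤k) ⟨
    u ⊕ ((k ∸ d + d) ⊙ (c ⊙ e i))              ≡⟨ absorb u (k ∸ d) c d i P≡dc ⟨
    (u ⊕ ((k ∸ d) ⊙ (c ⊙ e i))) ⊕ (P ⊙ e i)    ∎)
  where open ≡-Reasoning

-- Going up: an element of a linear set with dividing periods whose i-th
-- coordinate exceeds that of the base stays in the set when P·e_i is added
-- (some period along e_i was used, and P is a multiple of it).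
linear-up : ∀ {ℓ P} (r : Vec ℕ ℓ) ps v i → All (DividingPeriod P) ps → InLinear r ps v →
            lookup r i < lookup v i → InLinear r ps (v ⊕ (P ⊙ e i))
linear-up r [] v i [] refl r<r = ⊥-elim (<-irrefl refl r<r)
linear-up {P = P} r (p ∷ ps) v i ((j , c , refl , side) ∷ dps) (k , u , lin , refl) r<v with touches? j i side
... | inj₁ untouched =
  k , u ⊕ (P ⊙ e i) , linear-up r ps u i dps lin (subst (lookup r i <_) (lookup-untouched u k c j i untouched) r<v) ,
  ⊕-swap u (k ⊙ (c ⊙ e j)) (P ⊙ e i)
... | inj₂ (refl , divides d P≡dc) = k + d , u , lin , absorb u k c d j P≡dc

-- Peeling off the last period c·e_j
-- with coefficient k (w = u + k·c·e_j): if u_i is still large, P·e_i can be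
-- taken from u; otherwise the period runs along e_i with k·c > P = d·c, and
-- d copies of it can be dropped.
linear-down : ∀ {ℓ P} → 0 < P → ∀ (r : Vec ℕ ℓ) ps w v i → w ≡ v ⊕ (P ⊙ e i) → All (DividingPeriod P) ps →
              InLinear r ps w → lookup r i + length ps * P ≤ lookup v i → InLinear r ps v
linear-down {P = P} P>0 r [] w v i w≡ [] refl big =
  ⊥-elim (<-irrefl refl (<-≤-trans (m<m+n (lookup v i) P>0) (≤-trans (≤-reflexive w-i) (≤-trans (m≤m+n (lookup r i) 0) big))))
  where
  w-i : lookup v i + P ≡ lookup r i
  w-i = trans (sym (lookup-⊕⊙e-self v P i)) (cong (λ x → lookup x i) (sym w≡))
linear-down {ℓ} {P} P>0 r (p ∷ ps) w v i w≡ ((j , c , refl , side) ∷ dps) (k , u , lin , refl) big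
  with lookup r i + length ps * P + P ≤? lookup u i
... | yes large = from-rest (⊕⊙e-split u P i (≤-trans (m≤n+m P _) large))
  where
  from-rest : Σ (Vec ℕ ℓ) (λ u′ → u ≡ u′ ⊕ (P ⊙ e i)) → InLinear r (c ⊙ e j ∷ ps) v
  from-rest (u′ , refl) =
    k , u′ , linear-down P>0 r ps (u′ ⊕ (P ⊙ e i)) u′ i refl dps lin (+-cancelʳ-≤ P _ _ u′-large) ,
    ⊕-cancelʳ v (u′ ⊕ (k ⊙ (c ⊙ e j))) (P ⊙ e i) (trans (sym w≡) (⊕-swap u′ (P ⊙ e i) (k ⊙ (c ⊙ e j))))
    where
    u′-large : lookup r i + length ps * P + P ≤ lookup u′ i + P
    u′-large = subst (_ ≤_) (lookup-⊕⊙e-self u′ P i) large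
... | no small = from-period (touches? j i side)
  where
  v-large : lookup r i + length ps * P + P ≤ lookup v i
  v-large = subst (_≤ lookup v i) (trans (cong (lookup r i +_) (+-comm P (length ps * P))) (sym (+-assoc (lookup r i) _ P))) big
  w-i : lookup w i ≡ lookup v i + P
  w-i = trans (cong (λ x → lookup x i) w≡) (lookup-⊕⊙e-self v P i)
  from-period : ((c ≡ 0) ⊎ (j ≢ i)) ⊎ ((j ≡ i) × (c ∣ P)) → InLinear r (c ⊙ e j ∷ ps) v
  from-period (inj₁ untouched) = ⊥-elim (small (≤-trans v-large (≤-trans (m≤m+n (lookup v i) P)
    (≤-reflexive (trans (sym w-i) (lookup-untouched u k c j i untouched))))))
  from-period (inj₂ (refl , divides d P≡dc)) = k ∸ d , u , lin , unabsorb u v k c d j P≡dc (<⇒≤ d<k) (sym w≡)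
    where
    w-j : lookup w j ≡ lookup u j + k * c
    w-j = trans (cong (λ x → lookup (u ⊕ x) j) (⊙-⊙ k c (e j))) (lookup-⊕⊙e-self u (k * c) j)
    P<kc : P < k * c
    P<kc = ≰⇒> λ kc≤P → small (≤-trans v-large (+-cancelʳ-≤ P _ _
             (≤-trans (≤-reflexive (sym w-i)) (≤-trans (≤-reflexive w-j) (+-monoʳ-≤ (lookup u j) kc≤P)))))
    d<k : d < k
    d<k = *-cancelʳ-< c d k (subst (_< k * c) P≡dc P<kc)

linearThreshold : ∀ {ℓ} → ℕ → LinPres ℓ → ℕ
linearThreshold P (r , ps) = suc (Vec.sum r + length ps * P)

linear-periodic : ∀ {ℓ P} → 0 < P → ∀ (r : Vec ℕ ℓ) ps → All (DividingPeriod P) ps →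
                  Periodic (linearThreshold P (r , ps)) P (InLinear r ps)
linear-periodic {P = P} P>0 r ps dps v i T≤vi =
  mk⇔ (λ lin → linear-up r ps v i dps lin (<-≤-trans (s≤s (≤-trans (m≤m+n _ _) base≤)) T≤vi))
      (λ lin → linear-down P>0 r ps (v ⊕ (P ⊙ e i)) v i refl dps lin (≤-trans base≤ (<⇒≤ T≤vi)))
  where
  base≤ : lookup r i + length ps * P ≤ Vec.sum r + length ps * P
  base≤ = +-monoˡ-≤ (length ps * P) (lookup≤sum r i)

unionThreshold : ∀ {ℓ} → ℕ → List (LinPres ℓ) → ℕ
unionThreshold P Ls = ListAction.sum (List.map (linearThreshold P) Ls)

union-periodic : ∀ {ℓ P} → 0 < P → (Ls : List (LinPres ℓ)) → All (λ L → All (DividingPeriod P) (proj₂ L)) Ls →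
                 Periodic (unionThreshold P Ls) P (AnyLinear Ls)
union-periodic P>0 [] [] v i _ = mk⇔ (λ ()) (λ ())
union-periodic {P = P} P>0 ((r , ps) ∷ Ls) (dps ∷ dLs) v i T≤vi = mk⇔ up down
  where
  this : InLinear r ps v ⇔ InLinear r ps (v ⊕ (P ⊙ e i))
  this = periodic-raise {P = P} (m≤m+n _ _) (linear-periodic P>0 r ps dps) v i T≤vi
  rest : AnyLinear Ls v ⇔ AnyLinear Ls (v ⊕ (P ⊙ e i))
  rest = periodic-raise {P = P} (m≤n+m _ _) (union-periodic P>0 Ls dLs) v i T≤vi
  up : AnyLinear ((r , ps) ∷ Ls) v → AnyLinear ((r , ps) ∷ Ls) (v ⊕ (P ⊙ e i))
  up (here lin) = here (Equivalence.to this lin)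
  up (there any) = there (Equivalence.to rest any)
  down : AnyLinear ((r , ps) ∷ Ls) (v ⊕ (P ⊙ e i)) → AnyLinear ((r , ps) ∷ Ls) v
  down (here lin) = here (Equivalence.from this lin)
  down (there any) = there (Equivalence.from rest any)

-- The common period of a presentation: the product of the (positive) lengths
-- of all its periods; the length of c·e_i is its coordinate sum c.
periodLength : ∀ {ℓ} → Vec ℕ ℓ → ℕ
periodLength p = suc (pred (Vec.sum p))

commonPeriod : ∀ {ℓ} → List (LinPres ℓ) → ℕ
commonPeriod Ls = product (List.map periodLength (List.concatMap proj₂ Ls))

commonPeriod-positive : ∀ {ℓ} (Ls : List (LinPres ℓ)) → 0 < commonPeriod Ls
commonPeriod-positive Ls = >-nonZero⁻¹ (commonPeriod Ls)
  {{product≢0 (AllP.map⁺ (All.universal (λ _ → _) (List.concatMap proj₂ Ls)))}}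

canonical⇒dividing : ∀ {ℓ} (Ls : List (LinPres ℓ)) → All (λ L → All MultCanon (proj₂ L)) Ls →
                     All (λ L → All (DividingPeriod (commonPeriod Ls)) (proj₂ L)) Ls
canonical⇒dividing Ls canonical = All.tabulate λ {L} L∈Ls → All.tabulate λ {p} p∈L →
  dividing (All.lookup (All.lookup canonical L∈Ls) p∈L)
           (∈⇒∣product (∈-map⁺ periodLength (∈-concatMap⁺ proj₂ (lose L∈Ls p∈L))))
  where
  dividing : ∀ {P p} → MultCanon p → periodLength p ∣ P → DividingPeriod P p
  dividing (zero , i , p≡) _ = i , 0 , p≡ , inj₁ refl
  dividing {P} (suc c , i , refl) length∣P =
    i , suc c , refl , inj₂ (subst (_∣ P) (cong (suc ∘ pred) (sum-⊙e (suc c) i)) length∣P)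

semilinear-periodic : ∀ {ℓ} {Z : Vec ℕ ℓ → Set} → SemiLinearCanon ℓ Z →
                      Σ ℕ λ T → Σ ℕ λ P → (0 < P) × Periodic T P Z
semilinear-periodic (Ls , canonical , Z⇔) =
  unionThreshold (commonPeriod Ls) Ls , commonPeriod Ls , commonPeriod-positive Ls ,
  periodic-⇔ {P = commonPeriod Ls} Z⇔ (union-periodic (commonPeriod-positive Ls) Ls (canonical⇒dividing Ls canonical))

semilinear-decidable : ∀ {ℓ} {Z : Vec ℕ ℓ → Set} → SemiLinearCanon ℓ Z → Decidable Z
semilinear-decidable (Ls , _ , Z⇔) v =
  map′ (Equivalence.from (Z⇔ v)) (Equivalence.to (Z⇔ v)) (Any.any? (λ L → InLinear? (proj₁ L) (proj₂ L) v) Ls)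

module FiniteSystem {S : Set} {ℓ} (states : List S) (complete : ∀ s → s ∈ states)
                    (δ : S → Fin ℓ → S) (s₀ : S) (final : S → Bool) where
  position : S → Fin (length states)
  position s = Any.index (complete s)

  position-correct : ∀ s → List.lookup states (position s) ≡ s
  position-correct s = sym (AnyP.lookup-index (complete s))

  dfa : DFA ℓ
  dfa = record { nStates = length states ; start = position s₀
               ; δ = λ q a → position (δ (List.lookup states q) a)
               ; final = λ q → final (List.lookup states q) }

  run-dfa : ∀ q w → List.lookup states (run dfa q w) ≡ runWith δ (List.lookup states q) w
  run-dfa q [] = refl
  run-dfa q (a ∷ w) = trans (run-dfa (position (δ (List.lookup states q) a)) w)
                            (cong (λ s → runWith δ s w) (position-correct (δ (List.lookup states q) a)))

  accepts-dfa : ∀ w → accepts dfa w ≡ final (runWith δ s₀ w)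
  accepts-dfa w = cong final (trans (run-dfa (position s₀) w) (cong (λ s → runWith δ s w) (position-correct s₀)))

-- The automaton remembers whether the word read so far is sorted,
-- its last letter, and the residue (Reduction) of every letter count.
module PeriodicAutomaton (T P' : ℕ) {ℓ′} (Z : Vec ℕ (suc ℓ′) → Set)
                         (per : Periodic T (suc P') Z) (Z? : Decidable Z) where
  open Reduction T P'

  ℓ : ℕ
  ℓ = suc ℓ′

  State : Set
  State = Bool × Fin ℓ × Vec (Fin B) ℓ

  count : Vec (Fin B) ℓ → Word ℓ → Vec (Fin B) ℓ
  count c [] = c
  count c (a ∷ w) = count (updateAt c a step) w

  δ : State → Fin ℓ → State
  δ (sorted , last , c) a = (sorted ∧ (last ≤ᶠ a)) , a , updateAt c a step

  s₀ : State
  s₀ = true , fz , Vec.replicate ℓ fz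

  final : State → Bool
  final (sorted , _ , c) = sorted ∧ ⌊ Z? (Vec.map toℕ c) ⌋

  states : List State
  states = List.cartesianProduct (true ∷ false ∷ []) (List.cartesianProduct (List.allFin ℓ) (allVecs B ℓ))

  complete : ∀ s → s ∈ states
  complete (b , a , c) = ∈-cartesianProduct⁺ (bool∈ b) (∈-cartesianProduct⁺ (∈-allFin a) (allVecs-complete B c))
    where
    bool∈ : ∀ b → b ∈ true ∷ false ∷ []
    bool∈ true = here refl
    bool∈ false = there (here refl)

  run-sorted : ∀ s w → proj₁ (runWith δ s w) ≡ proj₁ s ∧ sortedFrom (proj₁ (proj₂ s)) w
  run-sorted (b , a , c) [] = sym (BoolP.∧-identityʳ b)
  run-sorted (b , a , c) (x ∷ w) = trans (run-sorted (δ (b , a , c) x) w) (BoolP.∧-assoc b (a ≤ᶠ x) _)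

  run-count : ∀ s w → proj₂ (proj₂ (runWith δ s w)) ≡ count (proj₂ (proj₂ s)) w
  run-count s [] = refl
  run-count s (a ∷ w) = run-count (δ s a) w

  lookup-step : ∀ (c : Vec (Fin B) ℓ) a i → lookup (updateAt c a step) i ≡ fold (lookup c i) step (kron i a)
  lookup-step c a i with i Fin.≟ a
  ... | yes refl = VecP.lookup∘updateAt i c
  ... | no i≢a = VecP.lookup∘updateAt′ i a i≢a c

  lookup-count : ∀ (c : Vec (Fin B) ℓ) w i → lookup (count c w) i ≡ fold (lookup c i) step (occ i w)
  lookup-count c [] i = refl
  lookup-count c (a ∷ w) i = begin
    lookup (count (updateAt c a step) w) i                       ≡⟨ lookup-count (updateAt c a step) w i ⟩
    fold (lookup (updateAt c a step) i) step (occ i w)          ≡⟨ cong (λ x → fold x step (occ i w)) (lookup-step c a i) ⟩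
    fold (fold (lookup c i) step (kron i a)) step (occ i w)     ≡⟨ fold-+ (lookup c i) step (occ i w) ⟨
    fold (lookup c i) step (occ i w + kron i a)                 ≡⟨ cong (fold (lookup c i) step) (+-comm (occ i w) (kron i a)) ⟩
    fold (lookup c i) step (occ i (a ∷ w))                      ∎
    where open ≡-Reasoning

  count-residues : ∀ w → Vec.map toℕ (count (Vec.replicate ℓ fz) w) ≡ Vec.map R (Ψ w)
  count-residues w = lookup-ext λ i → begin
    lookup (Vec.map toℕ (count (Vec.replicate ℓ fz) w)) i  ≡⟨ VecP.lookup-map i toℕ (count (Vec.replicate ℓ fz) w) ⟩
    toℕ (lookup (count (Vec.replicate ℓ fz) w) i)          ≡⟨ cong toℕ (lookup-count _ w i) ⟩
    toℕ (fold (lookup (Vec.replicate ℓ fz) i) step (occ i w)) ≡⟨ cong (λ x → toℕ (fold x step (occ i w))) (VecP.lookup-replicate i fz) ⟩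
    R (occ i w)                                             ≡⟨ cong R (lookup-Ψ w i) ⟨
    R (lookup (Ψ w) i)                                      ≡⟨ VecP.lookup-map i R (Ψ w) ⟨
    lookup (Vec.map R (Ψ w)) i                              ∎
    where open ≡-Reasoning

  open FiniteSystem states complete δ s₀ final public using (dfa; accepts-dfa)

  accepts-sorted-in-Z : ∀ w → (accepts dfa w ≡ true) ⇔ ((sortedFrom fz w ≡ true) × Z (Ψ w))
  accepts-sorted-in-Z w = mk⇔ to from
    where
    accepts≡ : accepts dfa w ≡ sortedFrom fz w ∧ ⌊ Z? (Vec.map toℕ (count (Vec.replicate ℓ fz) w)) ⌋
    accepts≡ = trans (accepts-dfa w) (cong₂ (λ b c → b ∧ ⌊ Z? (Vec.map toℕ c) ⌋) (run-sorted s₀ w) (run-count s₀ w))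
    in-Z : Z (Ψ w) ⇔ (⌊ Z? (Vec.map toℕ (count (Vec.replicate ℓ fz) w)) ⌋ ≡ true)
    in-Z = ⇔-trans (periodic-reduce per (Ψ w))
             (⇔-trans (⇔-cong Z (sym (count-residues w))) (dec-true (Z? _)))
    to : accepts dfa w ≡ true → (sortedFrom fz w ≡ true) × Z (Ψ w)
    to acc with ∧-true {sortedFrom fz w} (trans (sym accepts≡) acc)
    ... | sorted , z = sorted , Equivalence.from in-Z z
    from : (sortedFrom fz w ≡ true) × Z (Ψ w) → accepts dfa w ≡ true
    from (sorted , z) = trans accepts≡ (cong₂ _∧_ sorted (Equivalence.to in-Z z))

periodic⇒regular : ∀ {ℓ T P} {Z : Vec ℕ (suc ℓ) → Set} → 0 < P → Periodic T P Z → Decidable Z →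
                   Regular (λ w → (sortedFrom fz w ≡ true) × Z (Ψ w))
periodic⇒regular {T = T} {suc P'} {Z} _ per Z? =
  dfa , λ w → ⇔-sym (accepts-sorted-in-Z w)
  where open PeriodicAutomaton T P' Z per Z?

regular-⇔ : ∀ {ℓ} {L L′ : Word ℓ → Set} → (∀ w → L w ⇔ L′ w) → Regular L′ → Regular L
regular-⇔ L⇔L′ (D , L′⇔) = D , λ w → ⇔-trans (L⇔L′ w) (L′⇔ w)

semilinear-⇔ : ∀ {ℓ} {Z Z′ : Vec ℕ ℓ → Set} → (∀ v → Z v ⇔ Z′ v) → SemiLinearCanon ℓ Z′ → SemiLinearCanon ℓ Z
semilinear-⇔ Z⇔Z′ (Ls , canonical , Z′⇔) = Ls , canonical , λ v → ⇔-trans (Z⇔Z′ v) (Z′⇔ v)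

-- L is a block language if all its words lie in B_ℓ.  Such a language is
-- determined by its Parikh image, since Ψ is inverted by blockWord on B_ℓ.
BlockLanguage : ∀ ℓ → (Word ℓ → Set) → Set
BlockLanguage ℓ L = ∀ w → L w → InB ℓ w

ΨImage-accepted : ∀ {ℓ} {L : Word ℓ → Set} → BlockLanguage ℓ L → (D : DFA ℓ) →
                  (∀ w → L w ⇔ (accepts D w ≡ true)) → ∀ v → ΨImage L v ⇔ acceptedBlocks D v
ΨImage-accepted {L = L} blocks D L⇔ v = mk⇔ to from
  where
  to : ΨImage L v → acceptedBlocks D v
  to (w , Lw , refl) = subst (λ u → accepts D u ≡ true) (InB⇒blockWord-Ψ (blocks w Lw)) (Equivalence.to (L⇔ w) Lw)
  from : acceptedBlocks D v → ΨImage L v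
  from acc = blockWord v , Equivalence.from (L⇔ (blockWord v)) acc , Ψ-blockWord v

block-language-Ψ : ∀ {ℓ} {L : Word (suc ℓ) → Set} → BlockLanguage (suc ℓ) L →
                   ∀ w → L w ⇔ ((sortedFrom fz w ≡ true) × ΨImage L (Ψ w))
block-language-Ψ {L = L} blocks w = mk⇔ to from
  where
  to : L w → (sortedFrom fz w ≡ true) × ΨImage L (Ψ w)
  to Lw = subst (λ u → sortedFrom fz u ≡ true) (sym (InB⇒blockWord-Ψ (blocks w Lw))) (blockWord-sorted (Ψ w)) ,
          (w , Lw , refl)
  from : (sortedFrom fz w ≡ true) × ΨImage L (Ψ w) → L w
  from (sorted , (w′ , Lw′ , Ψw′≡Ψw)) = subst L w′≡w Lw′
    where
    w′≡w : w′ ≡ w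
    w′≡w = trans (InB⇒blockWord-Ψ (blocks w′ Lw′)) (trans (cong blockWord Ψw′≡Ψw) (sym (sorted⇒blockWord-Ψ w sorted)))

regular⇒semilinear : ∀ {ℓ} {L : Word ℓ → Set} → BlockLanguage ℓ L → Regular L → SemiLinearCanon ℓ (ΨImage L)
regular⇒semilinear blocks (D , L⇔) =
  semilinear-⇔ (ΨImage-accepted blocks D L⇔)
    (periodic⇒semilinear (1≤n! (DFA.nStates D)) (acceptedBlocks-periodic D) (λ v → accepts D (blockWord v) BoolP.≟ true))

semilinear⇒regular : ∀ {ℓ} {L : Word (suc ℓ) → Set} → BlockLanguage (suc ℓ) L → SemiLinearCanon (suc ℓ) (ΨImage L) → Regular L
semilinear⇒regular blocks semilinear with semilinear-periodic semilinear
... | _ , _ , P>0 , periodic =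
  regular-⇔ (block-language-Ψ blocks) (periodic⇒regular P>0 periodic (semilinear-decidable semilinear))

repSet-blocks : ∀ ℓ (X : ℕ → Set) → BlockLanguage ℓ (repSet ℓ X)
repSet-blocks ℓ X w (_ , _ , inB , _) = inB

lemma22 : (ℓ : ℕ) → 1 ≤ ℓ → (X : ℕ → Set) →
    Recognizable ℓ X ⇔ SemiLinearCanon ℓ (ΨImage (repSet ℓ X))
lemma22 (suc ℓ) _ X =
  mk⇔ (regular⇒semilinear (repSet-blocks (suc ℓ) X)) (semilinear⇒regular (repSet-blocks (suc ℓ) X))
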